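{- Let $X$ be a shift space. For every $n\ge1$ and $m\ge0$, the graph $\mathcal E_n(w)$ is a tree for all $w\in\mathcal L_{\ge m}(X)$ if and only if the graph $\mathcal E_{n+1}(w)$ is a tree for all $w\in\mathcal L_{\ge m}(X)$.
   Context: A shift space on a finite alphabet $A$ is a closed shift-invariant subset of $A^{\mathbb Z}$; $\mathcal L(X)$ is its set of finite factors, $\mathcal L_n(X)$ those of length $n$, $\mathcal L_{\ge m}(X)$ those of length at least $m$. For $w\in\mathcal L(X)$ and $n\ge1$: $L_n(w)=\{u\in\mathcal L_n(X):uw\in\mathcal L(X)\}$, $R_n(w)=\{v\in\mathcal L_n(X):wv\in\mathcal L(X)\}$; the extension graph $\mathcal E_n(w)$ is the undirected bipartite graph with vertex set the disjoint union of $L_n(w)$ and $R_n(w)$ and edges the pairs $(u,v)\in L_n(w)\times R_n(w)$ with $uwv\in\mathcal L(X)$. -}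

module Defs where

open import Data.Nat using (ℕ; zero; suc; _≤_)
open import Data.Fin using (Fin)
open import Data.Integer as ℤ using (ℤ; +_; -_)
open import Data.List using (List; []; _∷_; _++_; length)
open import Data.List.Relation.Unary.Linked using (Linked)
open import Data.List.Relation.Unary.Unique.Propositional using (Unique)
open import Data.Product using (Σ; ∃; _×_)
open import Data.Sum using (_⊎_; inj₁; inj₂)
open import Data.Empty using (⊥)
open import Relation.Nullary using (¬_)
open import Relation.Binary.PropositionalEquality using (_≡_)

Config : ℕ → Set
Config k = ℤ → Fin k

Word : ℕ → Set
Word k = List (Fin k)

σ : ∀ {k} → Config k → Config k
σ x i = x (i ℤ.+ + 1)

σ⁻¹ : ∀ {k} → Config k → Config k
σ⁻¹ x i = x (i ℤ.- + 1)

window : ∀ {k} → Config k → ℤ → ℕ → Word k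
window x i zero    = []
window x i (suc n) = x i ∷ window x (i ℤ.+ + 1) n

-- x lies in the closure of X for the product topology on A^ℤ:
-- every central block x[-N, N] agrees with some point of X
InClosure : ∀ {k} → (Config k → Set) → Config k → Set
InClosure X x = ∀ (N : ℕ) → ∃ λ y → X y ×
  (∀ (j : ℤ) → - (+ N) ℤ.≤ j → j ℤ.≤ + N → y j ≡ x j)

record IsShiftSpace {k : ℕ} (X : Config k → Set) : Set where
  field
    closed    : ∀ x → InClosure X x → X x
    shift     : ∀ x → X x → X (σ x)
    shift⁻¹   : ∀ x → X x → X (σ⁻¹ x)

𝓛 : ∀ {k} → (Config k → Set) → Word k → Set
𝓛 X w = ∃ λ x → X x × ∃ λ (i : ℤ) → window x i (length w) ≡ w

𝓛≥ : ∀ {k} → (Config k → Set) → ℕ → Word k → Set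
𝓛≥ X m w = m ≤ length w × 𝓛 X w

record Graph : Set₁ where
  field
    V     : Set
    Vert  : V → Set
    Adj   : V → V → Set      -- edges; intended symmetric, between vertices

module _ (G : Graph) where
  open Graph G

  Connected : Set
  Connected = ∀ x y → Vert x → Vert y →
    x ≡ y ⊎ ∃ λ vs → Linked Adj (x ∷ vs ++ y ∷ [])

  Cycle : Set
  Cycle = ∃ λ x → ∃ λ vs → 2 ≤ length vs × Unique (x ∷ vs) ×
    Linked Adj (x ∷ vs ++ x ∷ [])

  Acyclic : Set
  Acyclic = ¬ Cycle

  IsTree : Set
  IsTree = Connected × Acyclic

-- Extension graph E_n(w): vertices inj₁ u (u ∈ L_n(w)) and inj₂ v (v ∈ R_n(w))

Lₙ : ∀ {k} → (Config k → Set) → ℕ → Word k → Word k → Set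
Lₙ X n w u = length u ≡ n × 𝓛 X (u ++ w)

Rₙ : ∀ {k} → (Config k → Set) → ℕ → Word k → Word k → Set
Rₙ X n w v = length v ≡ n × 𝓛 X (w ++ v)

ExtVert : ∀ {k} → (Config k → Set) → ℕ → Word k → Word k ⊎ Word k → Set
ExtVert X n w (inj₁ u) = Lₙ X n w u
ExtVert X n w (inj₂ v) = Rₙ X n w v

ExtAdj : ∀ {k} → (Config k → Set) → ℕ → Word k →
         Word k ⊎ Word k → Word k ⊎ Word k → Set
ExtAdj X n w (inj₁ u) (inj₂ v) = Lₙ X n w u × Rₙ X n w v × 𝓛 X (u ++ w ++ v)
ExtAdj X n w (inj₂ v) (inj₁ u) = Lₙ X n w u × Rₙ X n w v × 𝓛 X (u ++ w ++ v)
ExtAdj X n w (inj₁ _) (inj₁ _) = ⊥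
ExtAdj X n w (inj₂ _) (inj₂ _) = ⊥

ExtGraph : ∀ {k} → (Config k → Set) → ℕ → Word k → Graph
ExtGraph {k} X n w = record
  { V = Word k ⊎ Word k ; Vert = ExtVert X n w ; Adj = ExtAdj X n w }

module Submission where

-- Let E_{p,q}(w) be the extension graph with left words of
-- length p and right words of length q, and T(p,q) the statement that
-- E_{p,q}(w) is a tree for all w ∈ 𝓛_{≥m}(X); the theorem is
-- T(n,n) ⇔ T(n+1,n+1).  E_{p,q+1}(w) is the union, over the right words V of
-- E_{p,q}(w), of copies of E_{p,1}(wV) (right letters b renamed Vb) glued
-- along their left vertices, and truncating right words maps it onto
-- E_{p,q}(w).  Comparing cycles and walks across this decomposition gives
--   narrowing  T(p,q+1) ⇒ T(p,q)   and   widening  T(p,1) ∧ T(p,q) ⇒ T(p,q+1).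
-- Reversing words swaps left and right, so both also hold on the left, and
-- T(n,n) ⇒ T(n,1) ⇒ T(n,n+1) ⇒ T(n+1,n+1), T(n+1,n+1) ⇒ T(n+1,n) ⇒ T(n,n).
-- Only factoriality and bi-extendability of 𝓛(X) are used.

open import Defs
open import Data.Nat as ℕ using (ℕ; zero; suc; _≤_; _≥_; z≤n; s≤s; _∸_)
import Data.Nat.Properties as ℕP
open import Data.Integer as ℤ using (ℤ; +_)
import Data.Integer.Properties as ℤP
open import Data.List using (List; []; _∷_; _++_; length; map; take; drop; head; last; reverse)
open import Data.List.Properties
  using (length-++; ++-assoc; ∷-injective; map-++; map-∘; length-map; take++drop≡id; length-drop;
         ++-cancelˡ; ++-identityʳ; length-++-≤ˡ; reverse-++; reverse-involutive; unfold-reverse; length-reverse)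
import Data.List.Properties as ListP
open import Data.Maybe using (just; nothing)
open import Data.Maybe.Relation.Binary.Connected using (just) renaming (Connected to MaybeConnected)
open import Data.Product using (Σ; ∃; ∃₂; _×_; _,_; proj₁; proj₂)
open import Data.Sum using (_⊎_; inj₁; inj₂)
open import Data.Sum.Properties using (inj₁-injective; inj₂-injective)
import Data.Sum.Properties as SumP
open import Data.Empty using (⊥; ⊥-elim)
open import Data.Unit using (⊤; tt)
open import Data.Fin using (_≟_)
open import Data.List.Relation.Unary.Linked as Linked using (Linked; []; [-]; _∷_)
import Data.List.Relation.Unary.Linked.Properties as LinkedP
open import Data.List.Relation.Unary.All as All using (All; []; _∷_)
import Data.List.Relation.Unary.All.Properties as AllP
open import Data.List.Relation.Unary.AllPairs using ([]; _∷_)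
open import Data.List.Relation.Unary.Any using (here; there; any?)
open import Data.List.Relation.Unary.Unique.Propositional using (Unique)
import Data.List.Relation.Unary.Unique.Propositional.Properties as UniqueP
open import Data.List.Membership.Propositional using (_∈_)
open import Data.List.Membership.Propositional.Properties using (∈-∃++)
open import Relation.Nullary using (¬_; yes; no)
open import Relation.Binary.Definitions using (DecidableEquality)
open import Relation.Binary.PropositionalEquality
open ≡-Reasoning

record FactorialExtendable {A : Set} (Lg : List A → Set) : Set where
  field
    prefix-closed : ∀ u v → Lg (u ++ v) → Lg u
    suffix-closed : ∀ u v → Lg (u ++ v) → Lg v
    extendˡ       : ∀ w → Lg w → ∃ λ a → Lg (a ∷ w)
    extendʳ       : ∀ w → Lg w → ∃ λ b → Lg (w ++ b ∷ [])

++-split : {A : Set} (xs xs' ys ys' : List A) → length xs ≡ length xs' →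
  xs ++ ys ≡ xs' ++ ys' → xs ≡ xs' × ys ≡ ys'
++-split []       []         ys ys' _ e = refl , e
++-split []       (_ ∷ _)    ys ys' () e
++-split (_ ∷ _)  []         ys ys' () e
++-split (x ∷ xs) (x' ∷ xs') ys ys' l e with ∷-injective e
... | x≡x' , e' with ++-split xs xs' ys ys' (cong ℕ.pred l) e'
... | xs≡xs' , ys≡ys' = cong₂ _∷_ x≡x' xs≡xs' , ys≡ys'

take-++-length : {A : Set} (v t : List A) → take (length v) (v ++ t) ≡ v
take-++-length []      t = refl
take-++-length (x ∷ v) t = cong (x ∷_) (take-++-length v t)

take-prefix : {A : Set} (V b : List A) (q : ℕ) → length V ≡ q → take q (V ++ b) ≡ V
take-prefix V b q lV = subst (λ q → take q (V ++ b) ≡ V) lV (take-++-length V b)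

module Windows {k : ℕ} (x : Config k) where

  length-window : ∀ i n → length (window x i n) ≡ n
  length-window i zero    = refl
  length-window i (suc n) = cong suc (length-window (i ℤ.+ + 1) n)

  window-++ : ∀ i a b → window x i (a ℕ.+ b) ≡ window x i a ++ window x (i ℤ.+ + a) b
  window-++ i zero    b = cong (λ j → window x j b) (sym (ℤP.+-identityʳ i))
  window-++ i (suc a) b = cong (x i ∷_) (begin
      window x (i ℤ.+ + 1) (a ℕ.+ b)
    ≡⟨ window-++ (i ℤ.+ + 1) a b ⟩
      window x (i ℤ.+ + 1) a ++ window x ((i ℤ.+ + 1) ℤ.+ + a) b
    ≡⟨ cong (λ j → window x (i ℤ.+ + 1) a ++ window x j b) shift ⟩
      window x (i ℤ.+ + 1) a ++ window x (i ℤ.+ + suc a) b ∎)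
    where
    shift : (i ℤ.+ + 1) ℤ.+ + a ≡ i ℤ.+ + suc a
    shift = trans (ℤP.+-assoc i (+ 1) (+ a)) (cong (λ z → i ℤ.+ z) (sym (ℤP.pos-+ 1 a)))

  window-split : ∀ i (u v : Word k) → window x i (length (u ++ v)) ≡ u ++ v →
    window x i (length u) ≡ u × window x (i ℤ.+ + length u) (length v) ≡ v
  window-split i u v occ = ++-split _ u _ v (length-window i (length u)) (begin
      window x i (length u) ++ window x (i ℤ.+ + length u) (length v)
    ≡⟨ window-++ i (length u) (length v) ⟨
      window x i (length u ℕ.+ length v)
    ≡⟨ cong (window x i) (length-++ u) ⟨
      window x i (length (u ++ v))
    ≡⟨ occ ⟩
      u ++ v ∎)

open Windows

language-factorialExtendable : ∀ {k} (X : Config k → Set) → FactorialExtendable (𝓛 X)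
language-factorialExtendable X = record
  { prefix-closed = prefix-closed ; suffix-closed = suffix-closed
  ; extendˡ = extendˡ ; extendʳ = extendʳ }
  where
  prefix-closed : ∀ u v → 𝓛 X (u ++ v) → 𝓛 X u
  prefix-closed u v (x , Xx , i , occ) = x , Xx , i , proj₁ (window-split x i u v occ)

  suffix-closed : ∀ u v → 𝓛 X (u ++ v) → 𝓛 X v
  suffix-closed u v (x , Xx , i , occ) =
    x , Xx , i ℤ.+ + length u , proj₂ (window-split x i u v occ)

  extendˡ : ∀ w → 𝓛 X w → ∃ λ a → 𝓛 X (a ∷ w)
  extendˡ w (x , Xx , i , occ) =
    x (i ℤ.- + 1) , x , Xx , i ℤ.- + 1 ,
    cong (x (i ℤ.- + 1) ∷_) (trans (cong (λ j → window x j (length w)) back) occ)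
    where
    back : (i ℤ.- + 1) ℤ.+ + 1 ≡ i
    back = begin
      (i ℤ.- + 1) ℤ.+ + 1    ≡⟨ ℤP.+-assoc i (ℤ.- + 1) (+ 1) ⟩
      i ℤ.+ (ℤ.- + 1 ℤ.+ + 1) ≡⟨ cong (λ z → i ℤ.+ z) (ℤP.+-inverseˡ (+ 1)) ⟩
      i ℤ.+ + 0               ≡⟨ ℤP.+-identityʳ i ⟩
      i                       ∎

  extendʳ : ∀ w → 𝓛 X w → ∃ λ b → 𝓛 X (w ++ b ∷ [])
  extendʳ w (x , Xx , i , occ) = x (i ℤ.+ + length w) , x , Xx , i , (begin
      window x i (length (w ++ x (i ℤ.+ + length w) ∷ []))
    ≡⟨ cong (window x i) (length-++ w) ⟩
      window x i (length w ℕ.+ 1)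
    ≡⟨ window-++ x i (length w) 1 ⟩
      window x i (length w) ++ x (i ℤ.+ + length w) ∷ []
    ≡⟨ cong (_++ x (i ℤ.+ + length w) ∷ []) occ ⟩
      w ++ x (i ℤ.+ + length w) ∷ [] ∎)

module LanguageProperties {A : Set} {Lg : List A → Set} (lang : FactorialExtendable Lg) where
  open FactorialExtendable lang

  extendˡ* : ∀ n z → Lg z → ∃ λ u → length u ≡ n × Lg (u ++ z)
  extendˡ* zero    z h = [] , refl , h
  extendˡ* (suc n) z h with extendˡ* n z h
  ... | u , lu , h' with extendˡ (u ++ z) h'
  ... | a , h'' = a ∷ u , cong suc lu , h''

  extendʳ* : ∀ n z → Lg z → ∃ λ t → length t ≡ n × Lg (z ++ t)
  extendʳ* zero    z h = [] , refl , subst Lg (sym (++-identityʳ z)) h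
  extendʳ* (suc n) z h with extendʳ z h
  ... | b , h' with extendʳ* n (z ++ b ∷ []) h'
  ... | t , lt , h'' = b ∷ t , cong suc lt , subst Lg (++-assoc z (b ∷ []) t) h''

  take-closed : ∀ z v a → Lg (z ++ v) → Lg (z ++ take a v)
  take-closed z v a h = prefix-closed (z ++ take a v) (drop a v) (subst Lg (begin
    z ++ v                     ≡⟨ cong (z ++_) (take++drop≡id a v) ⟨
    z ++ take a v ++ drop a v  ≡⟨ ++-assoc z (take a v) (drop a v) ⟨
    (z ++ take a v) ++ drop a v ∎) h)

  take-closed₃ : ∀ u w v a → Lg (u ++ w ++ v) → Lg (u ++ w ++ take a v)
  take-closed₃ u w v a h = subst Lg (++-assoc u w (take a v))
    (take-closed (u ++ w) v a (subst Lg (sym (++-assoc u w v)) h))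

data NonBacktracking {V : Set} : List V → Set where
  nb-nil    : NonBacktracking []
  nb-single : ∀ {x} → NonBacktracking (x ∷ [])
  nb-pair   : ∀ {x y} → NonBacktracking (x ∷ y ∷ [])
  nb-cons   : ∀ {x y z zs} → ¬ x ≡ z → NonBacktracking (y ∷ z ∷ zs) →
              NonBacktracking (x ∷ y ∷ z ∷ zs)

module _ {V : Set} where

  nb-tail : ∀ {x : V} {xs} → NonBacktracking (x ∷ xs) → NonBacktracking xs
  nb-tail nb-single      = nb-nil
  nb-tail nb-pair        = nb-single
  nb-tail (nb-cons _ nb) = nb

  nb-join : ∀ xs (a m : V) ys → NonBacktracking (xs ++ a ∷ m ∷ []) → NonBacktracking (m ∷ ys) →
    (∀ c → head ys ≡ just c → ¬ a ≡ c) → NonBacktracking (xs ++ a ∷ m ∷ ys)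
  nb-join []                 a m []       _               _   _     = nb-pair
  nb-join []                 a m (c ∷ ys) _               nb₂ a≢next   = nb-cons (a≢next c refl) nb₂
  nb-join (_ ∷ [])           a m ys       (nb-cons ne _)   nb₂ a≢next  =
    nb-cons ne (nb-join [] a m ys nb-pair nb₂ a≢next)
  nb-join (_ ∷ x₁ ∷ [])      a m ys       (nb-cons ne nb₁) nb₂ a≢next  =
    nb-cons ne (nb-join (x₁ ∷ []) a m ys nb₁ nb₂ a≢next)
  nb-join (_ ∷ x₁ ∷ x₂ ∷ xs) a m ys       (nb-cons ne nb₁) nb₂ a≢next  =
    nb-cons ne (nb-join (x₁ ∷ x₂ ∷ xs) a m ys nb₁ nb₂ a≢next)

  nb-map : {U : Set} (f : V → U) → (∀ {a b} → f a ≡ f b → a ≡ b) →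
    ∀ {xs} → NonBacktracking xs → NonBacktracking (map f xs)
  nb-map f inj nb-nil         = nb-nil
  nb-map f inj nb-single      = nb-single
  nb-map f inj nb-pair        = nb-pair
  nb-map f inj (nb-cons ne nb) = nb-cons (λ e → ne (inj e)) (nb-map f inj nb)

  last-∷≢nothing : ∀ (x : V) xs → ¬ last (x ∷ xs) ≡ nothing
  last-∷≢nothing x []       ()
  last-∷≢nothing x (y ∷ xs) = last-∷≢nothing y xs

  last-snoc : ∀ (x : V) vs y → last (x ∷ vs ++ y ∷ []) ≡ just y
  last-snoc x []       y = refl
  last-snoc x (v ∷ vs) y = last-snoc v vs y

  last-++-∷-∷ : ∀ (xs : List V) a m ys → last (xs ++ a ∷ m ∷ ys) ≡ last (m ∷ ys)
  last-++-∷-∷ []           a m ys = refl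
  last-++-∷-∷ (x ∷ [])     a m ys = refl
  last-++-∷-∷ (x ∷ y ∷ xs) a m ys = last-++-∷-∷ (y ∷ xs) a m ys

  last-∈ : ∀ (xs : List V) {y} → last xs ≡ just y → y ∈ xs
  last-∈ (x ∷ [])     refl = here refl
  last-∈ (x ∷ z ∷ xs) e    = there (last-∈ (z ∷ xs) e)

  last-∷-cong : ∀ (a : V) r r' → last r ≡ last r' → last (a ∷ r) ≡ last (a ∷ r')
  last-∷-cong a []      []        e = refl
  last-∷-cong a []      (b ∷ r')  e = ⊥-elim (last-∷≢nothing b r' (sym e))
  last-∷-cong a (b ∷ r) []        e = ⊥-elim (last-∷≢nothing b r e)
  last-∷-cong a (b ∷ r) (b' ∷ r') e = e

  last-view : ∀ (x : V) rest {y} → last (x ∷ rest) ≡ just y →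
    (rest ≡ [] × x ≡ y) ⊎ (∃ λ vs → rest ≡ vs ++ y ∷ [])
  last-view x []         refl = inj₁ (refl , refl)
  last-view x (z ∷ rest) e with last-view z rest e
  ... | inj₁ (refl , refl) = inj₂ ([] , refl)
  ... | inj₂ (vs , refl)   = inj₂ (z ∷ vs , refl)

  snoc-view : ∀ (xs : List V) → xs ≡ [] ⊎ ∃₂ λ ys a → xs ≡ ys ++ a ∷ []
  snoc-view [] = inj₁ refl
  snoc-view (x ∷ xs) with snoc-view xs
  ... | inj₁ refl           = inj₂ ([] , x , refl)
  ... | inj₂ (ys , a , refl) = inj₂ (x ∷ ys , a , refl)

  unique-rotate : ∀ (x : V) xs → Unique (x ∷ xs) → Unique (xs ++ x ∷ [])
  unique-rotate x []       _ = [] ∷ []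
  unique-rotate x (y ∷ ys) ((x≢y ∷ x∉) ∷ (y∉ ∷ u)) =
    snoc-∉ y∉ (λ e → x≢y (sym e)) ∷ unique-rotate x ys (x∉ ∷ u)
    where
    snoc-∉ : ∀ {zs} → All (λ z → ¬ y ≡ z) zs → ¬ y ≡ x → All (λ z → ¬ y ≡ z) (zs ++ x ∷ [])
    snoc-∉ []         y≢x = y≢x ∷ []
    snoc-∉ (p ∷ ps)   y≢x = p ∷ snoc-∉ ps y≢x

  unique-split : ∀ (x : V) ys zs → Unique (ys ++ x ∷ zs) → Unique (x ∷ ys)
  unique-split x []       zs u = [] ∷ []
  unique-split x (y ∷ ys) zs (y∉ ∷ u) with unique-split x ys zs u
  ... | x∉ ∷ u' = ((λ e → All.lookup y∉ (x∈ ys) (sym e)) ∷ x∉) ∷ (AllP.++⁻ˡ ys y∉ ∷ u')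
    where
    x∈ : ∀ ys → x ∈ ys ++ x ∷ zs
    x∈ []       = here refl
    x∈ (_ ∷ ys) = there (x∈ ys)

  module _ {R : V → V → Set} where

    linked-prefix : ∀ xs ys → Linked R (xs ++ ys) → Linked R xs
    linked-prefix []           ys l       = []
    linked-prefix (x ∷ [])     ys l       = [-]
    linked-prefix (x ∷ y ∷ xs) ys (r ∷ l) = r ∷ linked-prefix (y ∷ xs) ys l

    linked-join : ∀ xs m ys → Linked R (xs ++ m ∷ []) → Linked R (m ∷ ys) → Linked R (xs ++ m ∷ ys)
    linked-join []           m ys l₁       l₂ = l₂
    linked-join (a ∷ [])     m ys (r ∷ _)  l₂ = r ∷ l₂
    linked-join (a ∷ b ∷ xs) m ys (r ∷ l₁) l₂ = r ∷ linked-join (b ∷ xs) m ys l₁ l₂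

    linked-join₂ : ∀ xs a m ys → Linked R (xs ++ a ∷ m ∷ []) → Linked R (m ∷ ys) →
      Linked R (xs ++ a ∷ m ∷ ys)
    linked-join₂ []           a m ys (r ∷ _)  l₂ = r ∷ l₂
    linked-join₂ (x ∷ [])     a m ys (r ∷ l₁) l₂ = r ∷ linked-join₂ [] a m ys l₁ l₂
    linked-join₂ (x ∷ y ∷ xs) a m ys (r ∷ l₁) l₂ = r ∷ linked-join₂ (y ∷ xs) a m ys l₁ l₂

    linked-last-pair : ∀ xs a b → Linked R (xs ++ a ∷ b ∷ []) → R a b
    linked-last-pair []       a b (r ∷ _) = r
    linked-last-pair (x ∷ xs) a b l       = linked-last-pair xs a b (Linked.tail l)

module Reduction {V : Set} (_≟_ : DecidableEquality V) {R : V → V → Set} where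

  cons-cancel : V → List V → List V
  cons-cancel a []      = a ∷ []
  cons-cancel a (b ∷ []) = a ∷ b ∷ []
  cons-cancel a (b ∷ c ∷ r) with a ≟ c
  ... | yes _ = c ∷ r
  ... | no _  = a ∷ b ∷ c ∷ r

  reduced : List V → List V
  reduced []      = []
  reduced (a ∷ r) = cons-cancel a (reduced r)

  head-cons-cancel : ∀ a r → head (cons-cancel a r) ≡ just a
  head-cons-cancel a []          = refl
  head-cons-cancel a (b ∷ [])    = refl
  head-cons-cancel a (b ∷ c ∷ r) with a ≟ c
  ... | yes a≡c = cong just (sym a≡c)
  ... | no _    = refl

  last-cons-cancel : ∀ a r → last (cons-cancel a r) ≡ last (a ∷ r)
  last-cons-cancel a []          = refl
  last-cons-cancel a (b ∷ [])    = refl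
  last-cons-cancel a (b ∷ c ∷ r) with a ≟ c
  ... | yes _ = refl
  ... | no _  = refl

  nb-cons-cancel : ∀ a r → NonBacktracking r → NonBacktracking (cons-cancel a r)
  nb-cons-cancel a []          _  = nb-single
  nb-cons-cancel a (b ∷ [])    _  = nb-pair
  nb-cons-cancel a (b ∷ c ∷ r) nb with a ≟ c
  ... | yes _   = nb-tail nb
  ... | no a≢next  = nb-cons a≢next nb

  linked-cons-cancel : ∀ a r → Linked R r → MaybeConnected R (just a) (head r) → Linked R (cons-cancel a r)
  linked-cons-cancel a []          l _          = [-]
  linked-cons-cancel a (b ∷ [])    l (just rab) = rab ∷ [-]
  linked-cons-cancel a (b ∷ c ∷ r) l (just rab) with a ≟ c
  ... | yes _ = Linked.tail l
  ... | no _  = rab ∷ l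

  head-reduced : ∀ xs → head (reduced xs) ≡ head xs
  head-reduced []      = refl
  head-reduced (a ∷ r) = head-cons-cancel a (reduced r)

  last-reduced : ∀ xs → last (reduced xs) ≡ last xs
  last-reduced []      = refl
  last-reduced (a ∷ r) =
    trans (last-cons-cancel a (reduced r)) (last-∷-cong a (reduced r) r (last-reduced r))

  nb-reduced : ∀ xs → NonBacktracking (reduced xs)
  nb-reduced []      = nb-nil
  nb-reduced (a ∷ r) = nb-cons-cancel a (reduced r) (nb-reduced r)

  linked-reduced : ∀ xs → Linked R xs → Linked R (reduced xs)
  linked-reduced []      l = []
  linked-reduced (a ∷ r) l = linked-cons-cancel a (reduced r) (linked-reduced r (Linked.tail l))
    (subst (MaybeConnected R (just a)) (sym (head-reduced r)) (Linked.head′ l))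

  reduce : ∀ xs → Linked R xs →
    ∃ λ ys → Linked R ys × NonBacktracking ys × head ys ≡ head xs × last ys ≡ last xs
  reduce xs l = reduced xs , linked-reduced xs l , nb-reduced xs , head-reduced xs , last-reduced xs

-- In a loopless acyclic graph a walk without backtracking repeats no vertex:
-- a first repetition x … x would close a cycle.
nonBacktracking⇒unique : (Γ : Graph) → DecidableEquality (Graph.V Γ) →
  (∀ x → ¬ Graph.Adj Γ x x) → Acyclic Γ →
  ∀ xs → Linked (Graph.Adj Γ) xs → NonBacktracking xs → Unique xs
nonBacktracking⇒unique Γ _≟_ loopless acyclic = go
  where
  open Graph Γ
  go : ∀ xs → Linked Adj xs → NonBacktracking xs → Unique xs
  go []       l nb = []
  go (x ∷ xs) l nb with go xs (Linked.tail l) (nb-tail nb) | any? (x ≟_) xs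
  ... | u | no x∉xs = AllP.¬Any⇒All¬ xs x∉xs ∷ u
  ... | u | yes x∈xs with ∈-∃++ x∈xs
  ... | ys , zs , refl = ⊥-elim (repeat ys l nb u)
    where
    repeat : ∀ ys → Linked Adj (x ∷ ys ++ x ∷ zs) → NonBacktracking (x ∷ ys ++ x ∷ zs) →
      Unique (ys ++ x ∷ zs) → ⊥
    repeat []              l _              _ = loopless x (Linked.head l)
    repeat (y ∷ [])        _ (nb-cons x≢x _) _ = x≢x refl
    repeat (y₁ ∷ y₂ ∷ ys)  l _              u = acyclic (x , y₁ ∷ y₂ ∷ ys , s≤s (s≤s z≤n) ,
      unique-split x (y₁ ∷ y₂ ∷ ys) zs u ,
      linked-prefix (x ∷ y₁ ∷ y₂ ∷ ys ++ x ∷ []) zs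
        (subst (Linked Adj) (cong (λ t → x ∷ y₁ ∷ y₂ ∷ t) (sym (++-assoc ys (x ∷ []) zs))) l))

module _ {Γ Δ : Graph} where
  private
    module Γ = Graph Γ
    module Δ = Graph Δ

  connected-image : (f : Γ.V → Δ.V) → (∀ {a b} → Γ.Adj a b → Δ.Adj (f a) (f b)) →
    (∀ y → Δ.Vert y → ∃ λ x → Γ.Vert x × f x ≡ y) → Connected Γ → Connected Δ
  connected-image f hom onto conn y₁ y₂ v₁ v₂ with onto y₁ v₁ | onto y₂ v₂
  ... | x₁ , u₁ , refl | x₂ , u₂ , refl with conn x₁ x₂ u₁ u₂
  ... | inj₁ x₁≡x₂    = inj₁ (cong f x₁≡x₂)
  ... | inj₂ (vs , l) = inj₂ (map f vs ,
    subst (λ t → Linked Δ.Adj (f x₁ ∷ t)) (map-++ f vs (x₂ ∷ [])) (LinkedP.map⁺ (Linked.map hom l)))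

  acyclic-preimage : (g : Δ.V → Γ.V) → (∀ {a b} → g a ≡ g b → a ≡ b) →
    (∀ {a b} → Δ.Adj a b → Γ.Adj (g a) (g b)) → Acyclic Γ → Acyclic Δ
  acyclic-preimage g inj hom acyclic (x , vs , len , u , l) = acyclic (g x , map g vs ,
    subst (2 ≤_) (sym (length-map g vs)) len , UniqueP.map⁺ inj u ,
    subst (λ t → Linked Γ.Adj (g x ∷ t)) (map-++ g vs (x ∷ [])) (LinkedP.map⁺ (Linked.map hom l)))

  isTree-transport : (f : Γ.V → Δ.V) (g : Δ.V → Γ.V) → (∀ y → f (g y) ≡ y) →
    (∀ {a b} → Γ.Adj a b → Δ.Adj (f a) (f b)) → (∀ {a b} → Δ.Adj a b → Γ.Adj (g a) (g b)) →
    (∀ y → Δ.Vert y → Γ.Vert (g y)) → IsTree Γ → IsTree Δ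
  isTree-transport f g fg homf homg vert (conn , acyclic) =
    connected-image f homf (λ y v → g y , vert y v , fg y) conn ,
    acyclic-preimage g (λ {a} {b} e → trans (sym (fg a)) (trans (cong f e) (fg b))) homg acyclic

module ExtensionGraphs {A : Set} (_≟A_ : DecidableEquality A) (Lg : List A → Set) where

  W : Set
  W = List A

  _≟W_ : DecidableEquality W
  _≟W_ = ListP.≡-dec _≟A_

  _≟V_ : DecidableEquality (W ⊎ W)
  _≟V_ = SumP.≡-dec _≟W_ _≟W_

  EVert : ℕ → ℕ → W → W ⊎ W → Set
  EVert p q w (inj₁ u) = length u ≡ p × Lg (u ++ w)
  EVert p q w (inj₂ v) = length v ≡ q × Lg (w ++ v)

  EAdj : ℕ → ℕ → W → W ⊎ W → W ⊎ W → Set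
  EAdj p q w (inj₁ u) (inj₂ v) = EVert p q w (inj₁ u) × EVert p q w (inj₂ v) × Lg (u ++ w ++ v)
  EAdj p q w (inj₂ v) (inj₁ u) = EVert p q w (inj₁ u) × EVert p q w (inj₂ v) × Lg (u ++ w ++ v)
  EAdj p q w (inj₁ _) (inj₁ _) = ⊥
  EAdj p q w (inj₂ _) (inj₂ _) = ⊥

  E : ℕ → ℕ → W → Graph
  E p q w = record { V = W ⊎ W ; Vert = EVert p q w ; Adj = EAdj p q w }

  -- E is bipartite, so a walk from a left vertex x is described by a list of
  -- steps (V₁ , u₁) … (V_k , u_k): it visits x V₁ u₁ … V_k u_k.
  vertices : List (W × W) → List (W ⊎ W)
  vertices []            = []
  vertices ((V , u) ∷ c) = inj₂ V ∷ inj₁ u ∷ vertices c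

  lefts : List (W × W) → List W
  lefts = map proj₂

  rights : List (W × W) → List W
  rights = map proj₁

  HeadDiffers : W → List (W × W) → Set
  HeadDiffers V []             = ⊤
  HeadDiffers V ((V' , _) ∷ _) = ¬ V ≡ V'

  ConsecutiveDistinct : List (W × W) → Set
  ConsecutiveDistinct []            = ⊤
  ConsecutiveDistinct ((V , _) ∷ c) = HeadDiffers V c × ConsecutiveDistinct c

  left∈vertices : ∀ {z} c → z ∈ lefts c → inj₁ z ∈ vertices c
  left∈vertices (_ ∷ c) (here e)  = there (here (cong inj₁ e))
  left∈vertices (_ ∷ c) (there m) = there (there (left∈vertices c m))

  unique-lefts : ∀ c → Unique (vertices c) → Unique (lefts c)
  unique-lefts []      _ = []
  unique-lefts (_ ∷ c) (_ ∷ (u∉ ∷ U)) =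
    All.tabulate (λ {z} z∈ e → All.lookup u∉ (left∈vertices c z∈) (cong inj₁ e)) ∷ unique-lefts c U

  unique-consecutiveDistinct : ∀ c → Unique (vertices c) → ConsecutiveDistinct c
  unique-consecutiveDistinct []                    _ = tt
  unique-consecutiveDistinct (_ ∷ [])              _ = tt , tt
  unique-consecutiveDistinct (_ ∷ (V' , u') ∷ c) ((_ ∷ (V≢V' ∷ _)) ∷ (_ ∷ U)) =
    (λ e → V≢V' (cong inj₂ e)) , unique-consecutiveDistinct ((V' , u') ∷ c) U

  -- Compression merges consecutive steps through the same right vertex,
  -- keeping only the later one; in a closed walk through distinct left
  -- vertices this leaves a cycle unless only one right vertex is visited.
  insert : W × W → List (W × W) → List (W × W)
  insert (V , u) []              = (V , u) ∷ []
  insert (V , u) ((V' , u') ∷ r) with V ≟W V'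
  ... | yes _ = (V' , u') ∷ r
  ... | no _  = (V , u) ∷ (V' , u') ∷ r

  compress : List (W × W) → List (W × W)
  compress []      = []
  compress (s ∷ c) = insert s (compress c)

  compress-consecutiveDistinct : ∀ c → ConsecutiveDistinct (compress c)
  compress-consecutiveDistinct []            = tt
  compress-consecutiveDistinct ((V , u) ∷ c) = insert-cd (compress c) (compress-consecutiveDistinct c)
    where
    insert-cd : ∀ r → ConsecutiveDistinct r → ConsecutiveDistinct (insert (V , u) r)
    insert-cd []              _  = tt , tt
    insert-cd ((V' , u') ∷ r) cd with V ≟W V'
    ... | yes _  = cd
    ... | no V≢V' = V≢V' , cd

  insert-lefts : ∀ V u r {z} → z ∈ lefts (insert (V , u) r) → z ≡ u ⊎ z ∈ lefts r
  insert-lefts V u []              (here e) = inj₁ e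
  insert-lefts V u ((V' , u') ∷ r) m with V ≟W V'
  ... | yes _ = inj₂ m
  insert-lefts V u ((V' , u') ∷ r) (here e)  | no _ = inj₁ e
  insert-lefts V u ((V' , u') ∷ r) (there m) | no _ = inj₂ m

  compress-lefts : ∀ c {z} → z ∈ lefts (compress c) → z ∈ lefts c
  compress-lefts ((V , u) ∷ c) m with insert-lefts V u (compress c) m
  ... | inj₁ e  = here e
  ... | inj₂ m' = there (compress-lefts c m')

  compress-unique : ∀ c → Unique (lefts c) → Unique (lefts (compress c))
  compress-unique []            _        = []
  compress-unique ((V , u) ∷ c) (u∉ ∷ U) =
    insert-unique (compress c) (All.tabulate (λ m → All.lookup u∉ (compress-lefts c m)))
      (compress-unique c U)
    where
    insert-unique : ∀ r → All (λ z → ¬ u ≡ z) (lefts r) → Unique (lefts r) →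
      Unique (lefts (insert (V , u) r))
    insert-unique []              _   _ = [] ∷ []
    insert-unique ((V' , u') ∷ r) u∉r U with V ≟W V'
    ... | yes _ = U
    ... | no _  = u∉r ∷ U

  compress-rights : ∀ c → All (λ s → proj₁ s ∈ rights (compress c)) c
  compress-rights []            = []
  compress-rights ((V , u) ∷ c) =
    insert-here (compress c) ∷ All.map (insert-keep (compress c)) (compress-rights c)
    where
    insert-here : ∀ r → V ∈ rights (insert (V , u) r)
    insert-here []              = here refl
    insert-here ((V' , u') ∷ r) with V ≟W V'
    ... | yes e = here e
    ... | no _  = here refl
    insert-keep : ∀ r {z} → z ∈ rights r → z ∈ rights (insert (V , u) r)
    insert-keep ((V' , u') ∷ r) m with V ≟W V'
    ... | yes _ = m
    ... | no _  = there m

  module AlternatingWalks (p q : ℕ) (w : W) where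

    Adj : W ⊎ W → W ⊎ W → Set
    Adj = EAdj p q w

    Edge : W → W → Set
    Edge u V = Adj (inj₁ u) (inj₂ V)

    AltWalk : W → List (W × W) → W → Set
    AltWalk x []            y = x ≡ y
    AltWalk x ((V , u) ∷ c) y = Edge x V × Edge u V × AltWalk u c y

    Reduced : W → List (W × W) → Set
    Reduced x []            = ⊤
    Reduced x ((V , u) ∷ c) = ¬ x ≡ u × HeadDiffers V c × Reduced u c

    AltCycle : Set
    AltCycle = ∃ λ u₀ → ∃ λ c →
      AltWalk u₀ c u₀ × 2 ≤ length c × Unique (lefts c) × ConsecutiveDistinct c

    loopless : ∀ x → ¬ Adj x x
    loopless (inj₁ _) ()
    loopless (inj₂ _) ()

    altWalk-linked : ∀ x c y → AltWalk x c y → Linked Adj (inj₁ x ∷ vertices c)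
    altWalk-linked x []            y _           = [-]
    altWalk-linked x ((V , u) ∷ c) y (xV , uV , k) = xV ∷ uV ∷ altWalk-linked u c y k

    reduced-nonBacktracking : ∀ x c → Reduced x c → NonBacktracking (inj₁ x ∷ vertices c)
    reduced-nonBacktracking x []                     _                = nb-single
    reduced-nonBacktracking x ((V , u) ∷ [])         (x≢u , _ , _)    =
      nb-cons (λ e → x≢u (inj₁-injective e)) nb-pair
    reduced-nonBacktracking x ((V , u) ∷ (V' , u') ∷ c) (x≢u , V≢V' , r) =
      nb-cons (λ e → x≢u (inj₁-injective e))
        (nb-cons (λ e → V≢V' (inj₂-injective e)) (reduced-nonBacktracking u ((V' , u') ∷ c) r))

    altWalk-end : ∀ x s c y → AltWalk x (s ∷ c) y → inj₁ y ∈ vertices (s ∷ c)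
    altWalk-end x (V , u) []       y (_ , _ , u≡y) = there (here (cong inj₁ (sym u≡y)))
    altWalk-end x (V , u) (s' ∷ c) y (_ , _ , k)   = there (there (altWalk-end u s' c y k))

    altWalk-end-left : ∀ x s c y → AltWalk x (s ∷ c) y → y ∈ lefts (s ∷ c)
    altWalk-end-left x (V , u) []       y (_ , _ , u≡y) = here (sym u≡y)
    altWalk-end-left x (V , u) (s' ∷ c) y (_ , _ , k)   = there (altWalk-end-left u s' c y k)

    reduced-from : ∀ x c → Unique (x ∷ lefts c) → ConsecutiveDistinct c → Reduced x c
    reduced-from x []            _                  _          = tt
    reduced-from x ((V , u) ∷ c) ((x≢u ∷ _) ∷ U) (hd , cd) = x≢u , hd , reduced-from u c U cd

    altCycle-reduced : ∀ u₀ c → AltWalk u₀ c u₀ → 2 ≤ length c → Unique (lefts c) →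
      ConsecutiveDistinct c → Reduced u₀ c
    altCycle-reduced u₀ ((V₁ , u₁) ∷ s ∷ c) k (s≤s (s≤s _)) U@(u₁∉ ∷ _) (hd , cd) =
      u₀≢u₁ , hd , reduced-from u₁ (s ∷ c) U cd
      where
      u₀≢u₁ : ¬ u₀ ≡ u₁
      u₀≢u₁ e = All.lookup u₁∉ (altWalk-end-left u₁ s c u₀ (proj₂ (proj₂ k))) (sym e)

    -- An acyclic E p q w has no alternating cycle: its vertex list would be
    -- a closed walk without backtracking.
    altCycle-impossible : Acyclic (E p q w) → ¬ AltCycle
    altCycle-impossible acyclic (u₀ , s ∷ c , k , len , U , cd)
      with nonBacktracking⇒unique (E p q w) _≟V_ loopless acyclic (inj₁ u₀ ∷ vertices (s ∷ c))
             (altWalk-linked u₀ (s ∷ c) u₀ k)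
             (reduced-nonBacktracking u₀ (s ∷ c) (altCycle-reduced u₀ (s ∷ c) k len U cd))
    ... | u₀∉ ∷ _ = All.lookup u₀∉ (altWalk-end u₀ s c u₀ k) refl

    parse : ∀ u₀ x vs → Linked Adj (inj₁ x ∷ vs ++ inj₁ u₀ ∷ []) →
      ∃ λ c → vertices c ≡ vs ++ inj₁ u₀ ∷ [] × AltWalk x c u₀
    parse u₀ x []                        (() ∷ _)
    parse u₀ x (inj₁ _ ∷ vs)             (() ∷ _)
    parse u₀ x (inj₂ V ∷ [])             (xV ∷ Vu₀ ∷ _) = (V , u₀) ∷ [] , refl , xV , Vu₀ , refl
    parse u₀ x (inj₂ V ∷ inj₂ _ ∷ vs)    (_ ∷ () ∷ _)
    parse u₀ x (inj₂ V ∷ inj₁ u ∷ vs)    (xV ∷ Vu ∷ l) with parse u₀ u vs l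
    ... | c , e , k = (V , u) ∷ c , cong (λ t → inj₂ V ∷ inj₁ u ∷ t) e , xV , Vu , k

    private
      length-steps : ∀ c vs z → vertices c ≡ vs ++ z ∷ [] → 2 ≤ length vs → 2 ≤ length c
      length-steps []          []              z ()  _
      length-steps []          (_ ∷ _)         z ()  _
      length-steps (_ ∷ [])    (_ ∷ [])        z _   (s≤s ())
      length-steps (_ ∷ [])    (_ ∷ _ ∷ [])    z ()  _
      length-steps (_ ∷ [])    (_ ∷ _ ∷ _ ∷ _) z ()  _
      length-steps (_ ∷ _ ∷ _) vs              z _   _ = s≤s (s≤s z≤n)

      cycleAt-left : ∀ u₀ vs → 2 ≤ length vs → Unique (inj₁ u₀ ∷ vs) →
        Linked Adj (inj₁ u₀ ∷ vs ++ inj₁ u₀ ∷ []) → AltCycle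
      cycleAt-left u₀ vs len U l with parse u₀ u₀ vs l
      ... | c , e , k =
        u₀ , c , k , length-steps c vs _ e len , unique-lefts c Uc , unique-consecutiveDistinct c Uc
        where
        Uc : Unique (vertices c)
        Uc = subst Unique (sym e) (unique-rotate (inj₁ u₀) vs U)

    cycle→altCycle : Cycle (E p q w) → AltCycle
    cycle→altCycle (inj₁ u₀ , vs , len , U , l) = cycleAt-left u₀ vs len U l
    cycle→altCycle (inj₂ v , inj₂ _ ∷ vs , len , U , () ∷ _)
    cycle→altCycle (inj₂ v , inj₁ u₀ ∷ vs , len , U , vu₀ ∷ l) =
      cycleAt-left u₀ (vs ++ inj₂ v ∷ []) (len' vs len) (unique-rotate (inj₂ v) (inj₁ u₀ ∷ vs) U)
        (subst (λ t → Linked Adj (inj₁ u₀ ∷ t)) (sym (++-assoc vs (inj₂ v ∷ []) (inj₁ u₀ ∷ [])))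
          (linked-join (inj₁ u₀ ∷ vs) (inj₂ v) (inj₁ u₀ ∷ []) l (vu₀ ∷ [-])))
      where
      len' : ∀ vs → 2 ≤ suc (length vs) → 2 ≤ length (vs ++ inj₂ v ∷ [])
      len' []          (s≤s ())
      len' (_ ∷ [])    _ = s≤s (s≤s z≤n)
      len' (_ ∷ _ ∷ _) _ = s≤s (s≤s z≤n)

    compress-altWalk : ∀ x c y → AltWalk x c y → AltWalk x (compress c) y
    compress-altWalk x []            y k              = k
    compress-altWalk x ((V , u) ∷ c) y (xV , uV , k) =
      insert-altWalk (compress c) xV uV (compress-altWalk u c y k)
      where
      insert-altWalk : ∀ r → Edge x V → Edge u V → AltWalk u r y → AltWalk x (insert (V , u) r) y
      insert-altWalk []              xV uV k = xV , uV , k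
      insert-altWalk ((V' , u') ∷ r) xV uV k with V ≟W V'
      ... | yes refl = xV , proj₂ k
      ... | no _     = xV , uV , k

    -- In an acyclic E p q w, a closed alternating walk through distinct left
    -- vertices visits a single right vertex: its compression is not a cycle.
    closedWalk-one-right : Acyclic (E p q w) → ∀ u₀ c → AltWalk u₀ c u₀ → Unique (lefts c) →
      ∃ λ V* → All (λ s → proj₁ s ≡ V*) c
    closedWalk-one-right acyclic u₀ c k U
      with compress c | compress-rights c | compress-altWalk u₀ c u₀ k | compress-unique c U
         | compress-consecutiveDistinct c
    ... | []                 | cr | _  | _  | _  = [] , All.map (λ ()) cr
    ... | (V* , _) ∷ []      | cr | _  | _  | _  = V* , All.map (λ { (here e) → e }) cr
    ... | s₁ ∷ s₂ ∷ r        | _  | k' | U' | cd =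
      ⊥-elim (altCycle-impossible acyclic (u₀ , s₁ ∷ s₂ ∷ r , k' , s≤s (s≤s z≤n) , U' , cd))

  TreeFamily : ℕ → ℕ → ℕ → Set
  TreeFamily m p q = ∀ w → m ≤ length w → Lg w → IsTree (E p q w)

  module Refinement (lang : FactorialExtendable Lg) where
    open FactorialExtendable lang
    open LanguageProperties lang

    truncate : ℕ → W ⊎ W → W ⊎ W
    truncate a (inj₁ u) = inj₁ u
    truncate a (inj₂ v) = inj₂ (take a v)

    length-take-≤ : ∀ a (v : W) → a ≤ length v → length (take a v) ≡ a
    length-take-≤ a v a≤ = trans (ListP.length-take a v) (ℕP.m≤n⇒m⊓n≡m a≤)

    truncate-edge : ∀ p n a w → a ≤ n → ∀ u v →
      EAdj p n w (inj₁ u) (inj₂ v) → EAdj p a w (inj₁ u) (inj₂ (take a v))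
    truncate-edge p n a w a≤n u v (vu , (lv , Lwv) , Luwv) =
      vu , (length-take-≤ a v (subst (a ≤_) (sym lv) a≤n) , take-closed w v a Lwv) , take-closed₃ u w v a Luwv

    truncate-adj : ∀ p n a w → a ≤ n →
      ∀ {x y} → EAdj p n w x y → EAdj p a w (truncate a x) (truncate a y)
    truncate-adj p n a w a≤n {inj₁ u} {inj₂ v} = truncate-edge p n a w a≤n u v
    truncate-adj p n a w a≤n {inj₂ v} {inj₁ u} = truncate-edge p n a w a≤n u v

    truncate-onto : ∀ p n a w → a ≤ n →
      ∀ y → EVert p a w y → ∃ λ x → EVert p n w x × truncate a x ≡ y
    truncate-onto p n a w a≤n (inj₁ u) vu = inj₁ u , vu , refl
    truncate-onto p n a w a≤n (inj₂ v) (lv , Lwv) with extendʳ* (n ∸ a) (w ++ v) Lwv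
    ... | t , lt , Lwvt =
      inj₂ (v ++ t) ,
      (trans (length-++ v) (trans (cong₂ ℕ._+_ lv lt) (ℕP.m+[n∸m]≡n a≤n)) ,
       subst Lg (++-assoc w v t) Lwvt) ,
      cong inj₂ (subst (λ a → take a (v ++ t) ≡ v) lv (take-++-length v t))

    connected-truncate : ∀ p n a w → a ≤ n → Connected (E p n w) → Connected (E p a w)
    connected-truncate p n a w a≤n =
      connected-image (truncate a) (truncate-adj p n a w a≤n) (truncate-onto p n a w a≤n)

    -- For |V| = q, prefixing right words with V embeds E p 1 (w ++ V) into
    -- E p (q+1) w; the images of these copies cover E p (q+1) w and meet
    -- only in left vertices.
    prefixRight : W → W ⊎ W → W ⊎ W
    prefixRight V (inj₁ u) = inj₁ u
    prefixRight V (inj₂ b) = inj₂ (V ++ b)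

    prefixRight-injective : ∀ V {a b} → prefixRight V a ≡ prefixRight V b → a ≡ b
    prefixRight-injective V {inj₁ _} {inj₁ _} refl = refl
    prefixRight-injective V {inj₂ b} {inj₂ b'} e    = cong inj₂ (++-cancelˡ V b b' (inj₂-injective e))
    prefixRight-injective V {inj₁ _} {inj₂ _} ()
    prefixRight-injective V {inj₂ _} {inj₁ _} ()

    copy-edge : ∀ p q w V → length V ≡ q → ∀ u b →
      EAdj p 1 (w ++ V) (inj₁ u) (inj₂ b) → EAdj p (suc q) w (inj₁ u) (inj₂ (V ++ b))
    copy-edge p q w V lV u b ((lu , Luwv) , (lb , Lwvb) , Luwvb) =
      (lu , prefix-closed (u ++ w) V (subst Lg (sym (++-assoc u w V)) Luwv)) ,
      (trans (length-++ V) (trans (cong₂ ℕ._+_ lV lb) (ℕP.+-comm q 1)) , subst Lg (++-assoc w V b) Lwvb) ,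
      subst Lg (cong (u ++_) (++-assoc w V b)) Luwvb

    prefixRight-adj : ∀ p q w V → length V ≡ q →
      ∀ {a b} → EAdj p 1 (w ++ V) a b → EAdj p (suc q) w (prefixRight V a) (prefixRight V b)
    prefixRight-adj p q w V lV {inj₁ u} {inj₂ b} = copy-edge p q w V lV u b
    prefixRight-adj p q w V lV {inj₂ b} {inj₁ u} = copy-edge p q w V lV u b

    module Widening (p q : ℕ) (w : W) where
      private
        module G = AlternatingWalks p (suc q) w
        module H = AlternatingWalks p q w
        module P (V : W) = AlternatingWalks p 1 (w ++ V)

      front : W × W → W × W
      front s = take q (proj₁ s) , proj₂ s

      back : W × W → W × W
      back s = drop q (proj₁ s) , proj₂ s

      q≤1+q : q ≤ suc q
      q≤1+q = ℕP.n≤1+n q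

      front-altWalk : ∀ x c y → G.AltWalk x c y → H.AltWalk x (map front c) y
      front-altWalk x []            y k             = k
      front-altWalk x ((r , u) ∷ c) y (xr , ur , k) =
        truncate-edge p (suc q) q w q≤1+q x r xr ,
        truncate-edge p (suc q) q w q≤1+q u r ur , front-altWalk u c y k

      split-right : ∀ (V r : W) → take q r ≡ V → r ≡ V ++ drop q r
      split-right V r e = trans (sym (take++drop≡id q r)) (cong (_++ drop q r) e)

      back-edge : ∀ (V u r : W) → take q r ≡ V → G.Edge u r → P.Edge V u (drop q r)
      back-edge V u r e ((lu , _) , (lr , Lwr) , Luwr) =
        (lu , prefix-closed (u ++ w ++ V) d (subst Lg (sym reassoc) Luwvd)) ,
        (trans (length-drop q r) (trans (cong (_∸ q) lr) (ℕP.m+n∸n≡m 1 q)) ,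
         subst Lg (sym (++-assoc w V d)) Lwvd) ,
        subst Lg (sym (cong (u ++_) (++-assoc w V d))) Luwvd
        where
        d = drop q r
        Luwvd : Lg (u ++ w ++ V ++ d)
        Luwvd = subst (λ t → Lg (u ++ w ++ t)) (split-right V r e) Luwr
        Lwvd : Lg (w ++ V ++ d)
        Lwvd = subst (λ t → Lg (w ++ t)) (split-right V r e) Lwr
        reassoc : (u ++ w ++ V) ++ d ≡ u ++ w ++ V ++ d
        reassoc = trans (++-assoc u (w ++ V) d) (cong (u ++_) (++-assoc w V d))

      back-altWalk : ∀ (V x : W) c y → All (λ s → take q (proj₁ s) ≡ V) c →
        G.AltWalk x c y → P.AltWalk V x (map back c) y
      back-altWalk V x []            y _        k             = k
      back-altWalk V x ((r , u) ∷ c) y (e ∷ es) (xr , ur , k) =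
        back-edge V x r e xr , back-edge V u r e ur , back-altWalk V u c y es k

      back-consecutiveDistinct : ∀ (V : W) c → All (λ s → take q (proj₁ s) ≡ V) c →
        ConsecutiveDistinct c → ConsecutiveDistinct (map back c)
      back-consecutiveDistinct V []                        _             _         = tt
      back-consecutiveDistinct V (_ ∷ [])                  _             _         = tt , tt
      back-consecutiveDistinct V ((r , u) ∷ (r' , u') ∷ c) (e ∷ e' ∷ es) (hd , cd) =
        (λ d≡d' → hd (trans (split-right V r e) (trans (cong (V ++_) d≡d') (sym (split-right V r' e'))))) ,
        back-consecutiveDistinct V ((r' , u') ∷ c) (e' ∷ es) cd

      -- A cycle of E p (q+1) w projects to a closed walk of the tree E p q w,
      -- which stays at one right word V; so it is a cycle of the copy of
      -- E p 1 (w ++ V).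
      acyclic-widen : Acyclic (E p q w) →
        (∀ V → length V ≡ q → Lg (w ++ V) → Acyclic (E p 1 (w ++ V))) → Acyclic (E p (suc q) w)
      acyclic-widen acyclic acyclic-copies cyc with G.cycle→altCycle cyc
      ... | u₀ , c , k , len , U , cd
          with H.closedWalk-one-right acyclic u₀ (map front c) (front-altWalk u₀ c u₀ k)
                 (subst Unique (map-∘ c) U)
      ... | V , all-V = in-copy c k len U cd (AllP.map⁻ all-V)
        where
        in-copy : ∀ c → G.AltWalk u₀ c u₀ → 2 ≤ length c → Unique (lefts c) → ConsecutiveDistinct c →
          All (λ s → take q (proj₁ s) ≡ V) c → ⊥
        in-copy c@((r₁ , u₁) ∷ _) k len U cd all-V@(e₁ ∷ _) =
          P.altCycle-impossible V (acyclic-copies V lV LwV)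
            (u₀ , map back c , back-altWalk V u₀ c u₀ all-V k , subst (2 ≤_) (sym (length-map back c)) len ,
             subst Unique (map-∘ c) U , back-consecutiveDistinct V c all-V cd)
          where
          u₀r₁ = proj₁ k
          lV : length V ≡ q
          lV = subst (λ t → length t ≡ q) e₁
                 (length-take-≤ q r₁ (subst (q ≤_) (sym (proj₁ (proj₁ (proj₂ u₀r₁)))) q≤1+q))
          LwV : Lg (w ++ V)
          LwV = subst (λ t → Lg (w ++ t)) e₁ (take-closed w r₁ q (proj₂ (proj₁ (proj₂ u₀r₁))))

      Joined : W ⊎ W → W ⊎ W → Set
      Joined x y = x ≡ y ⊎ ∃ λ vs → Linked (EAdj p (suc q) w) (x ∷ vs ++ y ∷ [])

      joined-trans : ∀ {x y z} → Joined x y → Joined y z → Joined x z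
      joined-trans (inj₁ refl) j = j
      joined-trans (inj₂ v)    (inj₁ refl) = inj₂ v
      joined-trans {x} {y} {z} (inj₂ (vs , l₁)) (inj₂ (ws , l₂)) = inj₂ (vs ++ y ∷ ws ,
        subst (λ t → Linked (EAdj p (suc q) w) (x ∷ t)) (sym (++-assoc vs (y ∷ ws) (z ∷ [])))
          (linked-join (x ∷ vs) y (ws ++ z ∷ []) l₁ l₂))

      module _ (connected-copies : ∀ V → length V ≡ q → Lg (w ++ V) → Connected (E p 1 (w ++ V))) where

        joined-through : ∀ u u' V → H.Edge u V → H.Edge u' V → Joined (inj₁ u) (inj₁ u')
        joined-through u u' V ((lu , _) , (lV , LwV) , LuwV) ((lu' , _) , _ , Lu'wV)
          with connected-copies V lV LwV (inj₁ u) (inj₁ u') (lu , LuwV) (lu' , Lu'wV)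
        ... | inj₁ e        = inj₁ e
        ... | inj₂ (vs , l) = inj₂ (map (prefixRight V) vs ,
          subst (λ t → Linked (EAdj p (suc q) w) (inj₁ u ∷ t)) (map-++ (prefixRight V) vs (inj₁ u' ∷ []))
            (LinkedP.map⁺ (Linked.map (prefixRight-adj p q w V lV) l)))

        joined-along : ∀ u zs u' → Linked (EAdj p q w) (inj₁ u ∷ zs ++ inj₁ u' ∷ []) →
          Joined (inj₁ u) (inj₁ u')
        joined-along u []                          u' (() ∷ _)
        joined-along u (inj₁ _ ∷ zs)               u' (() ∷ _)
        joined-along u (inj₂ V ∷ [])               u' (uV ∷ Vu' ∷ _) = joined-through u u' V uV Vu'
        joined-along u (inj₂ V ∷ inj₂ _ ∷ zs)      u' (_ ∷ () ∷ _)
        joined-along u (inj₂ V ∷ inj₁ u'' ∷ zs)    u' (uV ∷ Vu'' ∷ l) =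
          joined-trans (joined-through u u'' V uV Vu'') (joined-along u'' zs u' l)

        left-anchor : ∀ x → EVert p (suc q) w x →
          ∃ λ u → EVert p q w (inj₁ u) × Joined x (inj₁ u) × Joined (inj₁ u) x
        left-anchor (inj₁ u) vu = u , vu , inj₁ refl , inj₁ refl
        left-anchor (inj₂ r) (lr , Lwr) with extendˡ* p (w ++ r) Lwr
        ... | u , lu , Luwr = u , (lu , Luw) , inj₂ ([] , edge ∷ [-]) , inj₂ ([] , edge ∷ [-])
          where
          Luw = prefix-closed (u ++ w) r (subst Lg (sym (++-assoc u w r)) Luwr)
          edge : EAdj p (suc q) w (inj₁ u) (inj₂ r)
          edge = (lu , Luw) , (lr , Lwr) , Luwr

        connected-widen : Connected (E p q w) → Connected (E p (suc q) w)
        connected-widen connected x y vx vy with left-anchor x vx | left-anchor y vy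
        ... | u₁ , v₁ , xu₁ , _ | u₂ , v₂ , _ , u₂y with connected (inj₁ u₁) (inj₁ u₂) v₁ v₂
        ... | inj₁ refl      = joined-trans xu₁ u₂y
        ... | inj₂ (zs , l)  = joined-trans xu₁ (joined-trans (joined-along u₁ zs u₂ l) u₂y)

    -- Narrowing: when the copies are connected, cycles of E p q w lift to
    -- E p (q+1) w.
    module Narrowing (p q : ℕ) (w : W) where
      private
        module G = AlternatingWalks p (suc q) w
        module H = AlternatingWalks p q w
        AdjG = EAdj p (suc q) w

      InCopy : W → W ⊎ W → Set
      InCopy V (inj₁ _) = ⊤
      InCopy V (inj₂ r) = take q r ≡ V

      prefixRight-inCopy : ∀ V → length V ≡ q → ∀ z → InCopy V (prefixRight V z)
      prefixRight-inCopy V lV (inj₁ _) = tt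
      prefixRight-inCopy V lV (inj₂ b) = take-prefix V b q lV

      -- the walk L continues in the copy of the first right vertex of c
      StartsLike : List (W × W) → List (W ⊎ W) → Set
      StartsLike []            L = L ≡ []
      StartsLike ((V , _) ∷ _) L = (∃ λ z → head L ≡ just z) × (∀ z → head L ≡ just z → InCopy V z)

      -- a walk in E p (q+1) w without backtracking lifting the alternating walk x c y
      Lift : W → List (W × W) → W → Set
      Lift x c y = Σ (List (W ⊎ W)) λ L → Linked AdjG (inj₁ x ∷ L) × NonBacktracking (inj₁ x ∷ L) ×
        last (inj₁ x ∷ L) ≡ just (inj₁ y) × StartsLike c L

      module _ (connected-copies : ∀ V → length V ≡ q → Lg (w ++ V) → Connected (E p 1 (w ++ V))) where

        copy-path : ∀ x u V → H.Edge x V → H.Edge u V → ¬ x ≡ u → ∃₂ λ M b →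
          Linked (EAdj p 1 (w ++ V)) (inj₁ x ∷ M ++ inj₂ b ∷ inj₁ u ∷ []) ×
          NonBacktracking (inj₁ x ∷ M ++ inj₂ b ∷ inj₁ u ∷ [])
        copy-path x u V ((lx , _) , (lV , LwV) , LxwV) ((lu , _) , _ , LuwV) x≢u
          with connected-copies V lV LwV (inj₁ x) (inj₁ u) (lx , LxwV) (lu , LuwV)
        ... | inj₁ e = ⊥-elim (x≢u (inj₁-injective e))
        ... | inj₂ (vs , l) with Reduction.reduce _≟V_ (inj₁ x ∷ vs ++ inj₁ u ∷ []) l
        ... | [] , _ , _ , () , _
        ... | _ ∷ rest , lY , nbY , refl , lastY
          with last-view (inj₁ x) rest (trans lastY (last-snoc (inj₁ x) vs (inj₁ u)))
        ... | inj₁ (_ , e) = ⊥-elim (x≢u (inj₁-injective e))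
        ... | inj₂ (R , refl) with snoc-view R
        ... | inj₁ refl = ⊥-elim (Linked.head lY)
        ... | inj₂ (M , inj₁ a , refl) =
          ⊥-elim (linked-last-pair (inj₁ x ∷ M) (inj₁ a) (inj₁ u)
            (subst (Linked _) (cong (inj₁ x ∷_) (++-assoc M (inj₁ a ∷ []) (inj₁ u ∷ []))) lY))
        ... | inj₂ (M , inj₂ b , refl) = M , b , subst (Linked _) reassoc lY , subst NonBacktracking reassoc nbY
          where
          reassoc = cong (inj₁ x ∷_) (++-assoc M (inj₂ b ∷ []) (inj₁ u ∷ []))

        lift-step : ∀ x u V → H.Edge x V → H.Edge u V → ¬ x ≡ u → ∃₂ λ M b →
          Linked AdjG (inj₁ x ∷ map (prefixRight V) M ++ inj₂ (V ++ b) ∷ inj₁ u ∷ []) ×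
          NonBacktracking (inj₁ x ∷ map (prefixRight V) M ++ inj₂ (V ++ b) ∷ inj₁ u ∷ [])
        lift-step x u V xV uV x≢u with copy-path x u V xV uV x≢u
        ... | M , b , l , nb = M , b ,
          subst (Linked AdjG) image (LinkedP.map⁺ (Linked.map (prefixRight-adj p q w V lV) l)) ,
          subst NonBacktracking image (nb-map (prefixRight V) (prefixRight-injective V) nb)
          where
          lV = proj₁ (proj₁ (proj₂ xV))
          image = cong (inj₁ x ∷_) (map-++ (prefixRight V) M (inj₂ b ∷ inj₁ u ∷ []))

        -- Lifting step by step: consecutive steps use different copies, so
        -- the concatenation does not backtrack.
        lift : ∀ x c y → H.AltWalk x c y → H.Reduced x c → Lift x c y
        lift x []            y x≡y _ = [] , [-] , nb-single , cong (λ t → just (inj₁ t)) x≡y , refl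
        lift x ((V , u) ∷ c) y (xV , uV , k) (x≢u , hd , r) with lift u c y k r | lift-step x u V xV uV x≢u
        ... | L , l , nb , end , starts | M , b , l' , nb' =
          map (prefixRight V) M ++ inj₂ (V ++ b) ∷ inj₁ u ∷ L ,
          linked-join₂ (inj₁ x ∷ map (prefixRight V) M) (inj₂ (V ++ b)) (inj₁ u) L l' l ,
          nb-join (inj₁ x ∷ map (prefixRight V) M) (inj₂ (V ++ b)) (inj₁ u) L nb' nb (turns c hd starts) ,
          trans (last-++-∷-∷ (inj₁ x ∷ map (prefixRight V) M) (inj₂ (V ++ b)) (inj₁ u) L) end ,
          starts-in-copy M
          where
          lV : length V ≡ q
          lV = proj₁ (proj₁ (proj₂ xV))
          turns : ∀ c → HeadDiffers V c → StartsLike c L →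
            ∀ z → head L ≡ just z → ¬ inj₂ (V ++ b) ≡ z
          turns []             _    refl      z ()  _
          turns ((V' , _) ∷ _) V≢V' (_ , inV') z hL refl = V≢V' (trans (sym (take-prefix V b q lV)) (inV' _ hL))
          starts-in-copy : ∀ M →
            StartsLike ((V , u) ∷ c) (map (prefixRight V) M ++ inj₂ (V ++ b) ∷ inj₁ u ∷ L)
          starts-in-copy []      = (_ , refl) , λ { z refl → take-prefix V b q lV }
          starts-in-copy (m ∷ M) = (_ , refl) , λ { z refl → prefixRight-inCopy V lV m }

        -- A cycle of E p q w lifts to a closed walk of E p (q+1) w without
        -- backtracking, impossible in a tree.
        acyclic-narrow : Acyclic (E p (suc q) w) → Acyclic (E p q w)
        acyclic-narrow acyclic cyc with H.cycle→altCycle cyc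
        ... | u₀ , c , k , len , U , cd with lift u₀ c u₀ k (H.altCycle-reduced u₀ c k len U cd)
        ... | [] , _ , _ , refl , starts = ⊥-elim (non-empty c len starts)
          where
          non-empty : ∀ c → 2 ≤ length c → ¬ StartsLike c []
          non-empty (_ ∷ _) _ ((_ , ()) , _)
        ... | z ∷ L , l , nb , end , _
          with nonBacktracking⇒unique (E p (suc q) w) _≟V_ G.loopless acyclic (inj₁ u₀ ∷ z ∷ L) l nb
        ... | u₀∉ ∷ _ = All.lookup u₀∉ (last-∈ (z ∷ L) end) refl

    private
      longer : ∀ {m} (w V : W) → m ≤ length w → m ≤ length (w ++ V)
      longer w V m≤ = ℕP.≤-trans m≤ (length-++-≤ˡ w)

    -- T(p, q+1) ⇒ T(p, q); the copies are trees by truncation, being of the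
    -- form E p 1 (w ++ V) with |w ++ V| ≥ m
    narrow : ∀ m p q → TreeFamily m p (suc q) → TreeFamily m p q
    narrow m p q trees w m≤ Lw =
      connected-truncate p (suc q) q w (ℕP.n≤1+n q) (proj₁ (trees w m≤ Lw)) ,
      Narrowing.acyclic-narrow p q w connected-copies (proj₂ (trees w m≤ Lw))
      where
      connected-copies : ∀ V → length V ≡ q → Lg (w ++ V) → Connected (E p 1 (w ++ V))
      connected-copies V _ LwV =
        connected-truncate p (suc q) 1 (w ++ V) (s≤s z≤n) (proj₁ (trees (w ++ V) (longer w V m≤) LwV))

    widen : ∀ m p q → TreeFamily m p 1 → TreeFamily m p q → TreeFamily m p (suc q)
    widen m p q trees₁ trees w m≤ Lw =
      Widening.connected-widen p q w (λ V _ LwV → proj₁ (copy V LwV)) (proj₁ (trees w m≤ Lw)) ,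
      Widening.acyclic-widen p q w (proj₂ (trees w m≤ Lw)) (λ V _ LwV → proj₂ (copy V LwV))
      where
      copy : ∀ V → Lg (w ++ V) → IsTree (E p 1 (w ++ V))
      copy V LwV = trees₁ (w ++ V) (longer w V m≤) LwV

    narrow-to-one : ∀ m p q → TreeFamily m p (suc q) → TreeFamily m p 1
    narrow-to-one m p zero    trees = trees
    narrow-to-one m p (suc q) trees = narrow-to-one m p q (narrow m p (suc q) trees)

    widen-by-one : ∀ m p q → TreeFamily m p (suc q) → TreeFamily m p (suc (suc q))
    widen-by-one m p q trees = widen m p (suc q) (narrow-to-one m p q trees) trees

-- Reversing words exchanges left and right extensions.  Lr mirrors Lg when
-- Lr w holds exactly when Lg (reverse w) does.
Mirror : {A : Set} → (List A → Set) → (List A → Set) → Set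
Mirror Lg Lr = ∀ w → (Lr w → Lg (reverse w)) × (Lg (reverse w) → Lr w)

mirror-sym : {A : Set} {Lg Lr : List A → Set} → Mirror Lg Lr → Mirror Lr Lg
mirror-sym {Lg = Lg} mirror w =
  (λ Lw → proj₂ (mirror (reverse w)) (subst Lg (sym (reverse-involutive w)) Lw)) ,
  (λ Lr-rw → subst Lg (reverse-involutive w) (proj₁ (mirror (reverse w)) Lr-rw))

reverse-++₃ : {A : Set} (a w b : List A) → reverse (a ++ w ++ b) ≡ reverse b ++ reverse w ++ reverse a
reverse-++₃ a w b = begin
  reverse (a ++ w ++ b)                 ≡⟨ reverse-++ a (w ++ b) ⟩
  reverse (w ++ b) ++ reverse a         ≡⟨ cong (_++ reverse a) (reverse-++ w b) ⟩
  (reverse b ++ reverse w) ++ reverse a ≡⟨ ++-assoc (reverse b) (reverse w) (reverse a) ⟩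
  reverse b ++ reverse w ++ reverse a   ∎

module Mirrored {A : Set} (_≟A_ : DecidableEquality A) (Lg Lr : List A → Set) (mirror : Mirror Lg Lr) where

  private
    module EG = ExtensionGraphs _≟A_ Lg
    module ER = ExtensionGraphs _≟A_ Lr

    to-Lr : ∀ {x y} → reverse x ≡ y → Lg x → Lr y
    to-Lr {x} {y} rx≡y Lx =
      proj₂ (mirror y) (subst Lg (trans (sym (reverse-involutive x)) (cong reverse rx≡y)) Lx)

    to-Lg : ∀ {x y} → reverse x ≡ y → Lr x → Lg y
    to-Lg {x} rx≡y Lx = subst Lg rx≡y (proj₁ (mirror x) Lx)

  mirror-factorialExtendable : FactorialExtendable Lg → FactorialExtendable Lr
  mirror-factorialExtendable lang = record
    { prefix-closed = λ u v h → to-Lr (reverse-involutive u)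
        (suffix-closed (reverse v) (reverse u) (to-Lg (reverse-++ u v) h))
    ; suffix-closed = λ u v h → to-Lr (reverse-involutive v)
        (prefix-closed (reverse v) (reverse u) (to-Lg (reverse-++ u v) h))
    ; extendˡ = λ w h → let (b , h') = extendʳ (reverse w) (to-Lg refl h)
        in b , to-Lr (trans (reverse-++ (reverse w) (b ∷ [])) (cong (b ∷_) (reverse-involutive w))) h'
    ; extendʳ = λ w h → let (a , h') = extendˡ (reverse w) (to-Lg refl h)
        in a , to-Lr (trans (unfold-reverse a (reverse w)) (cong (_++ a ∷ []) (reverse-involutive w))) h'
    }
    where open FactorialExtendable lang

  swap : EG.W ⊎ EG.W → EG.W ⊎ EG.W
  swap (inj₁ a) = inj₂ (reverse a)
  swap (inj₂ b) = inj₁ (reverse b)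

  swap-involutive : ∀ x → swap (swap x) ≡ x
  swap-involutive (inj₁ a) = cong inj₁ (reverse-involutive a)
  swap-involutive (inj₂ b) = cong inj₂ (reverse-involutive b)

  module _ (p q : ℕ) (w : EG.W) where

    swap-vert : ∀ y → ER.EVert q p w y → EG.EVert p q (reverse w) (swap y)
    swap-vert (inj₁ a) (la , Law) = trans (length-reverse a) la , to-Lg (reverse-++ a w) Law
    swap-vert (inj₂ b) (lb , Lwb) = trans (length-reverse b) lb , to-Lg (reverse-++ w b) Lwb

    swap-adj⁻ : ∀ {a b} → ER.EAdj q p w a b → EG.EAdj p q (reverse w) (swap a) (swap b)
    swap-adj⁻ {inj₁ a} {inj₂ b} (va , vb , Lawb) =
      swap-vert (inj₂ b) vb , swap-vert (inj₁ a) va , to-Lg (reverse-++₃ a w b) Lawb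
    swap-adj⁻ {inj₂ b} {inj₁ a} (va , vb , Lawb) =
      swap-vert (inj₂ b) vb , swap-vert (inj₁ a) va , to-Lg (reverse-++₃ a w b) Lawb

    swap-adj : ∀ {a b} → EG.EAdj p q (reverse w) a b → ER.EAdj q p w (swap a) (swap b)
    swap-adj {inj₁ u} {inj₂ v} ((lu , Lu) , (lv , Lv) , Luv) =
      (trans (length-reverse v) lv , to-Lr (trans (reverse-++ (reverse w) v) (cong (reverse v ++_) ww)) Lv) ,
      (trans (length-reverse u) lu , to-Lr (trans (reverse-++ u (reverse w)) (cong (_++ reverse u) ww)) Lu) ,
      to-Lr (trans (reverse-++₃ u (reverse w) v) (cong (λ t → reverse v ++ t ++ reverse u) ww)) Luv
      where
      ww : reverse (reverse w) ≡ w
      ww = reverse-involutive w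
    swap-adj {inj₂ v} {inj₁ u} = swap-adj {inj₁ u} {inj₂ v}

    -- E_{q,p}(w) of Lr is E_{p,q}(reverse w) of Lg with sides swapped
    isTree-mirror : IsTree (EG.E p q (reverse w)) → IsTree (ER.E q p w)
    isTree-mirror = isTree-transport swap swap swap-involutive swap-adj swap-adj⁻ swap-vert

  treeFamily-mirror : ∀ m p q → EG.TreeFamily m p q → ER.TreeFamily m q p
  treeFamily-mirror m p q trees w m≤ Lw =
    isTree-mirror p q w (trees (reverse w) (subst (m ≤_) (sym (length-reverse w)) m≤) (to-Lg refl Lw))

module ExtensionTrees {k : ℕ} (X : Config k → Set) (m : ℕ) where

  private
    Lr : Word k → Set
    Lr w = 𝓛 X (reverse w)

    mirror : Mirror (𝓛 X) Lr
    mirror w = (λ h → h) , (λ h → h)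

    module G = ExtensionGraphs _≟_ (𝓛 X)
    module R = ExtensionGraphs _≟_ Lr
    module GRefine = G.Refinement (language-factorialExtendable X)
    module RRefine = R.Refinement (Mirrored.mirror-factorialExtendable _≟_ (𝓛 X) Lr mirror
                                     (language-factorialExtendable X))

    to-mirror : ∀ p q → G.TreeFamily m p q → R.TreeFamily m q p
    to-mirror = Mirrored.treeFamily-mirror _≟_ (𝓛 X) Lr mirror m

    from-mirror : ∀ p q → R.TreeFamily m p q → G.TreeFamily m q p
    from-mirror = Mirrored.treeFamily-mirror _≟_ Lr (𝓛 X) (mirror-sym mirror) m

    from-ext-adj : ∀ p w {a b} → ExtAdj X p w a b → G.EAdj p p w a b
    from-ext-adj p w {inj₁ _} {inj₂ _} e = e
    from-ext-adj p w {inj₂ _} {inj₁ _} e = e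

    to-ext-adj : ∀ p w {a b} → G.EAdj p p w a b → ExtAdj X p w a b
    to-ext-adj p w {inj₁ _} {inj₂ _} e = e
    to-ext-adj p w {inj₂ _} {inj₁ _} e = e

    from-ext-vert : ∀ p w y → ExtVert X p w y → G.EVert p p w y
    from-ext-vert p w (inj₁ _) v = v
    from-ext-vert p w (inj₂ _) v = v

    to-ext-vert : ∀ p w y → G.EVert p p w y → ExtVert X p w y
    to-ext-vert p w (inj₁ _) v = v
    to-ext-vert p w (inj₂ _) v = v

  fromExtGraph : ∀ p → (∀ w → 𝓛≥ X m w → IsTree (ExtGraph X p w)) → G.TreeFamily m p p
  fromExtGraph p trees w m≤ Lw =
    isTree-transport {ExtGraph X p w} {G.E p p w} (λ x → x) (λ x → x) (λ _ → refl)
    (from-ext-adj p w) (to-ext-adj p w) (to-ext-vert p w) (trees w (m≤ , Lw))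

  toExtGraph : ∀ p → G.TreeFamily m p p → ∀ w → 𝓛≥ X m w → IsTree (ExtGraph X p w)
  toExtGraph p trees w (m≤ , Lw) =
    isTree-transport {G.E p p w} {ExtGraph X p w} (λ x → x) (λ x → x) (λ _ → refl)
    (to-ext-adj p w) (from-ext-adj p w) (from-ext-vert p w) (trees w m≤ Lw)

  -- T(n+1, n+1) ⇒ T(n+1, n+2) ⇒ T(n+2, n+2), widening on the right and then,
  -- in the mirror image, on the left
  grow : ∀ n → G.TreeFamily m (suc n) (suc n) → G.TreeFamily m (suc (suc n)) (suc (suc n))
  grow n trees = from-mirror (suc (suc n)) (suc (suc n))
    (RRefine.widen-by-one m (suc (suc n)) n
      (to-mirror (suc n) (suc (suc n)) (GRefine.widen-by-one m (suc n) n trees)))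

  -- T(n+1, n+1) ⇒ T(n+1, n) ⇒ T(n, n), narrowing on both sides
  shrink : ∀ n → G.TreeFamily m (suc n) (suc n) → G.TreeFamily m n n
  shrink n trees =
    from-mirror n n (RRefine.narrow m n n (to-mirror (suc n) n (GRefine.narrow m (suc n) n trees)))

proposition8p1 : (k : ℕ) (X : Config k → Set) → IsShiftSpace X →
    (n m : ℕ) → n ≥ 1 →
    ((∀ w → 𝓛≥ X m w → IsTree (ExtGraph X n w)) →
       (∀ w → 𝓛≥ X m w → IsTree (ExtGraph X (suc n) w)))
    × ((∀ w → 𝓛≥ X m w → IsTree (ExtGraph X (suc n) w)) →
       (∀ w → 𝓛≥ X m w → IsTree (ExtGraph X n w)))
proposition8p1 k X _ (suc n) m (s≤s z≤n) =
  (λ trees → toExtGraph (suc (suc n)) (grow n (fromExtGraph (suc n) trees))) ,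
  (λ trees → toExtGraph (suc n) (shrink (suc n) (fromExtGraph (suc (suc n)) trees)))
  where open ExtensionTrees X m
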